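{- Let $n\geq 1$ and let $B_{1},\ldots,B_{n}$ be square matrices, each of odd order at least $3$. If $A=B_{1}\otimes\cdots\otimes B_{n}$ (Kronecker product), then $$\mathscr{C}(A)=\prod_{i=1}^{n}\mathscr{C}(B_{i})\qquad\text{and}\qquad \mathscr{M}_{3}(A)=\Big(\prod_{i=1}^{n-1}\mathscr{C}(B_{i})\Big)\,\mathscr{M}_{3}(B_{n}).$$
   Context: For a square matrix $A=(a_{i,j})$ of odd order $m$, its center is $\mathscr{C}(A):=a_{\frac{m+1}{2},\frac{m+1}{2}}$. For a square matrix $A$ of odd order $m\geq 3$, $\mathscr{M}_{3}(A)$ denotes the $3\times 3$ principal submatrix of $A$ with rows and columns indexed by $\frac{m-1}{2},\frac{m+1}{2},\frac{m+3}{2}$. -}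

module Defs where

open import Level using (Level)
open import Algebra.Bundles using (CommutativeRing)
open import Data.Nat as ℕ using (ℕ; zero; suc; _∸_; _/_; _<?_)
open import Data.Fin as Fin using (Fin; zero; suc; fromℕ<; quotient; remainder; inject₁)
open import Data.Product using (Σ; _,_; proj₁; proj₂)
open import Relation.Nullary using (yes; no)

module Matrices {c ℓ : Level} (R : CommutativeRing c ℓ) where
  open CommutativeRing R using (Carrier; _≈_; _*_; 0#; 1#)

  Mat : ℕ → Set c
  Mat m = Fin m → Fin m → Carrier

  -- Kronecker product: (A ⊗ B)[(i,k),(j,l)] = A[i,j] * B[k,l],
  -- with the pair (i,k) encoded as i * q + k (standard ordering)
  _⊗_ : ∀ {p q} → Mat p → Mat q → Mat (p ℕ.* q)
  _⊗_ {p} {q} A B I J =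
    A (quotient q I) (quotient q J) * B (remainder {p} q I) (remainder {p} q J)

  -- entry lookup by natural-number (0-based) indices; 0# outside the range
  -- (only ever used in range for odd orders ≥ 3)
  entry : ∀ {m} → Mat m → ℕ → ℕ → Carrier
  entry {m} A i j with i <? m | j <? m
  ... | yes i<m | yes j<m = A (fromℕ< i<m) (fromℕ< j<m)
  ... | _       | _       = 0#

  -- center C(A) = a_{(m+1)/2,(m+1)/2} (1-based) = entry (m/2, m/2) (0-based, m odd)
  center : ∀ {m} → Mat m → Carrier
  center {m} A = entry A (m / 2) (m / 2)

  -- M₃(A): principal 3×3 submatrix on 1-based rows/cols (m-1)/2,(m+1)/2,(m+3)/2,
  -- i.e. 0-based indices m/2 - 1, m/2, m/2 + 1 (m odd, m ≥ 3)
  M₃ : ∀ {m} → Mat m → Mat 3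
  M₃ {m} A a b = entry A (m / 2 ∸ 1 ℕ.+ Fin.toℕ a) (m / 2 ∸ 1 ℕ.+ Fin.toℕ b)

  _≈R_ : Carrier → Carrier → Set ℓ
  _≈R_ = _≈_

  _·₃_ : Carrier → Mat 3 → Mat 3
  (x ·₃ M) a b = x * M a b

  _≈₃_ : Mat 3 → Mat 3 → Set ℓ
  M ≈₃ N = ∀ a b → M a b ≈ N a b

  prod : ∀ n → (Fin n → Carrier) → Carrier
  prod zero    f = 1#
  prod (suc n) f = f zero * prod n (λ i → f (suc i))

  -- B₁ ⊗ B₂ ⊗ ⋯ ⊗ B_{n+1}, for a family of n+1 square matrices of orders ord i
  kron : ∀ n (ord : Fin (suc n) → ℕ) → ((i : Fin (suc n)) → Mat (ord i))
       → Σ ℕ Mat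
  kron zero    ord B = ord zero , B zero
  kron (suc n) ord B =
    ord zero ℕ.* proj₁ rest , (B zero ⊗ proj₂ rest)
    where rest = kron n (λ i → ord (suc i)) (λ i → B (suc i))

-- Write the order of A ⊗ B as p q with p = 2a + 1 odd. The central index
-- (p q) / 2 = q a + q / 2 of A ⊗ B is the index of the pair (central index a of A,
-- central index q / 2 of B), and so are its two neighbours q a + q / 2 ± 1 once q ≥ 3.
-- Hence C(A ⊗ B) = C(A) C(B) and M₃(A ⊗ B) = C(A) M₃(B), and splitting
-- B₁ ⊗ ⋯ ⊗ Bₙ as B₁ ⊗ (B₂ ⊗ ⋯ ⊗ Bₙ) gives the theorem by induction on n.
module Submission where

open import Defs
open import Level using (Level)
open import Algebra.Bundles using (CommutativeRing)
open import Data.Nat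
  using (ℕ; zero; suc; _+_; _*_; _∸_; _/_; _%_; _≤_; _<_; _<?_; z≤n; s≤s; s≤s⁻¹; NonZero; >-nonZero)
open import Data.Product using (Σ; _×_; _,_; proj₁; proj₂)
open import Data.Nat.Properties
  using (≤-trans; m≤m+n; m≤m*n; m≤n*m; +-∸-assoc; +-assoc; +-comm; *-comm; +-mono-≤-<; module ≤-Reasoning)
open import Data.Nat.DivMod
  using (m≡m%n+[m/n]*n; /-congˡ; %-congˡ; +-distrib-/-∣ˡ; m*n/n≡m; m/n<m; m≥n⇒m/n>0;
         m/n≡1+[m∸n]/n; %-distribˡ-*; [m+kn]%n≡m%n)
open import Data.Nat.Divisibility using (divides)
open import Data.Nat.Tactic.RingSolver using (solve-∀)
open import Data.Fin using (Fin; zero; suc; inject₁; fromℕ; toℕ; fromℕ<; combine; quotient; remainder)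
open import Data.Fin.Properties using (fromℕ<-toℕ; toℕ-fromℕ<; toℕ-combine; toℕ<n; remQuot-combine)
open import Relation.Nullary using (yes; no)
open import Relation.Nullary.Negation using (contradiction)
import Relation.Binary.Reasoning.Setoid
open import Relation.Binary.PropositionalEquality
  using (_≡_; refl; sym; trans; cong; cong₂; subst; module ≡-Reasoning)

odd⇒nonZero : ∀ {p} → p % 2 ≡ 1 → NonZero p
odd⇒nonZero {suc _} _ = _

odd⇒m≡1+[m/2]*2 : ∀ p → p % 2 ≡ 1 → p ≡ suc (p / 2 * 2)
odd⇒m≡1+[m/2]*2 p p-odd = trans (m≡m%n+[m/n]*n p 2) (cong (_+ p / 2 * 2) p-odd)

odd⇒m/2<m : ∀ p → p % 2 ≡ 1 → p / 2 < p
odd⇒m/2<m p p-odd = subst (p / 2 <_) (sym (odd⇒m≡1+[m/2]*2 p p-odd)) (s≤s (m≤m*n (p / 2) 2))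

odd⇒m*n/2≡n*[m/2]+n/2 : ∀ p q → p % 2 ≡ 1 → p * q / 2 ≡ q * (p / 2) + q / 2
odd⇒m*n/2≡n*[m/2]+n/2 p q p-odd = begin
  p * q / 2                       ≡⟨ /-congˡ {o = 2} (cong (_* q) (odd⇒m≡1+[m/2]*2 p p-odd)) ⟩
  suc (p / 2 * 2) * q / 2         ≡⟨ /-congˡ {o = 2} (expand (p / 2) q) ⟩
  (q * (p / 2) * 2 + q) / 2       ≡⟨ +-distrib-/-∣ˡ q (divides (q * (p / 2)) refl) ⟩
  q * (p / 2) * 2 / 2 + q / 2     ≡⟨ cong (_+ q / 2) (m*n/n≡m (q * (p / 2)) 2) ⟩
  q * (p / 2) + q / 2             ∎
  where
  open ≡-Reasoning
  expand : ∀ h q → suc (h * 2) * q ≡ q * h * 2 + q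
  expand = solve-∀

[3+2*k]%2≡1 : ∀ k → (3 + 2 * k) % 2 ≡ 1
[3+2*k]%2≡1 k = trans (%-congˡ {o = 2} (cong (3 +_) (*-comm 2 k))) ([m+kn]%n≡m%n 3 k 2)

M₃-index< : ∀ {q} → 3 ≤ q → (t : Fin 3) → q / 2 ∸ 1 + toℕ t < q
M₃-index< {q@(suc (suc (suc r)))} (s≤s (s≤s (s≤s _))) t = begin-strict
  q / 2 ∸ 1 + toℕ t   ≡⟨ cong (λ x → x ∸ 1 + toℕ t) (m/n≡1+[m∸n]/n {q} {2} (s≤s (s≤s z≤n))) ⟩
  suc r / 2 + toℕ t   <⟨ +-mono-≤-< (s≤s⁻¹ (m/n<m (suc r) 2 (s≤s (s≤s z≤n)))) (toℕ<n t) ⟩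
  r + 3               ≡⟨ +-comm r 3 ⟩
  q                   ∎
  where open ≤-Reasoning

M₃-index-⊗ : ∀ p q → p % 2 ≡ 1 → 2 ≤ q → ∀ t →
                 p * q / 2 ∸ 1 + t ≡ q * (p / 2) + (q / 2 ∸ 1 + t)
M₃-index-⊗ p q p-odd 2≤q t = begin
  p * q / 2 ∸ 1 + t               ≡⟨ cong (λ x → x ∸ 1 + t) (odd⇒m*n/2≡n*[m/2]+n/2 p q p-odd) ⟩
  q * (p / 2) + q / 2 ∸ 1 + t     ≡⟨ cong (_+ t) (+-∸-assoc (q * (p / 2)) (m≥n⇒m/n>0 {n = 2} 2≤q)) ⟩
  q * (p / 2) + (q / 2 ∸ 1) + t   ≡⟨ +-assoc (q * (p / 2)) (q / 2 ∸ 1) t ⟩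
  q * (p / 2) + (q / 2 ∸ 1 + t)   ∎
  where open ≡-Reasoning

module _ {c ℓ : Level} (R : CommutativeRing c ℓ) where
  open CommutativeRing R
    using (Carrier; _≈_; setoid; *-cong; *-assoc; *-identityˡ; *-identityʳ)
    renaming (_*_ to _·_; refl to ≈-refl; sym to ≈-sym)
  open Matrices R

  entry-toℕ : ∀ {m} (A : Mat m) (i j : Fin m) → entry A (toℕ i) (toℕ j) ≡ A i j
  entry-toℕ {m} A i j with toℕ i <? m | toℕ j <? m
  ... | yes i<m | yes j<m = cong₂ A (fromℕ<-toℕ i i<m) (fromℕ<-toℕ j j<m)
  ... | no i≮m  | _       = contradiction (toℕ<n i) i≮m
  ... | yes _   | no j≮m  = contradiction (toℕ<n j) j≮m

  entry-fromℕ< : ∀ {m i j} (A : Mat m) (i<m : i < m) (j<m : j < m) →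
                 entry A i j ≡ A (fromℕ< i<m) (fromℕ< j<m)
  entry-fromℕ< A i<m j<m =
    trans (cong₂ (entry A) (sym (toℕ-fromℕ< i<m)) (sym (toℕ-fromℕ< j<m)))
          (entry-toℕ A (fromℕ< i<m) (fromℕ< j<m))

  ⊗-combine : ∀ {p q} (A : Mat p) (B : Mat q) (i j : Fin p) (k l : Fin q) →
              (A ⊗ B) (combine i k) (combine j l) ≡ A i j · B k l
  ⊗-combine A B i j k l =
    cong₂ _·_ (cong₂ A (quotient-combine i k) (quotient-combine j l))
              (cong₂ B (remainder-combine i k) (remainder-combine j l))
    where
    quotient-combine : ∀ {p q} (x : Fin p) (y : Fin q) → quotient q (combine x y) ≡ x
    quotient-combine x y = cong proj₁ (remQuot-combine x y)
    remainder-combine : ∀ {p q} (x : Fin p) (y : Fin q) → remainder {p} q (combine x y) ≡ y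
    remainder-combine x y = cong proj₂ (remQuot-combine x y)

  entry-⊗ : ∀ {p q i j r s} (A : Mat p) (B : Mat q) →
            i < p → j < p → r < q → s < q →
            entry (A ⊗ B) (q * i + r) (q * j + s) ≡ entry A i j · entry B r s
  entry-⊗ {p} {q} {i} {j} {r} {s} A B i<p j<p r<q s<q = begin
    entry (A ⊗ B) (q * i + r) (q * j + s)
      ≡⟨ cong₂ (entry (A ⊗ B)) (toℕ-combine-fromℕ< i<p r<q) (toℕ-combine-fromℕ< j<p s<q) ⟨
    entry (A ⊗ B) (toℕ (combine (fromℕ< i<p) (fromℕ< r<q))) (toℕ (combine (fromℕ< j<p) (fromℕ< s<q)))
      ≡⟨ entry-toℕ (A ⊗ B) _ _ ⟩
    (A ⊗ B) (combine (fromℕ< i<p) (fromℕ< r<q)) (combine (fromℕ< j<p) (fromℕ< s<q))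
      ≡⟨ ⊗-combine A B _ _ _ _ ⟩
    A (fromℕ< i<p) (fromℕ< j<p) · B (fromℕ< r<q) (fromℕ< s<q)
      ≡⟨ cong₂ _·_ (entry-fromℕ< A i<p j<p) (entry-fromℕ< B r<q s<q) ⟨
    entry A i j · entry B r s ∎
    where
    open ≡-Reasoning
    toℕ-combine-fromℕ< : ∀ {x y} (x<p : x < p) (y<q : y < q) →
                         toℕ (combine (fromℕ< x<p) (fromℕ< y<q)) ≡ q * x + y
    toℕ-combine-fromℕ< x<p y<q =
      trans (toℕ-combine (fromℕ< x<p) (fromℕ< y<q))
            (cong₂ (λ x y → q * x + y) (toℕ-fromℕ< x<p) (toℕ-fromℕ< y<q))

  center-⊗ : ∀ {p q} (A : Mat p) (B : Mat q) .{{_ : NonZero q}} → p % 2 ≡ 1 →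
             center (A ⊗ B) ≡ center A · center B
  center-⊗ {p} {q} A B p-odd =
    trans (cong (λ x → entry (A ⊗ B) x x) (odd⇒m*n/2≡n*[m/2]+n/2 p q p-odd))
          (entry-⊗ A B (odd⇒m/2<m p p-odd) (odd⇒m/2<m p p-odd) q/2<q q/2<q)
    where
    q/2<q : q / 2 < q
    q/2<q = m/n<m q 2 (s≤s (s≤s z≤n))

  M₃-⊗ : ∀ {p q} (A : Mat p) (B : Mat q) → p % 2 ≡ 1 → 3 ≤ q →
         ∀ a b → M₃ (A ⊗ B) a b ≡ (center A ·₃ M₃ B) a b
  M₃-⊗ {p} {q} A B p-odd 3≤q a b =
    trans (cong₂ (entry (A ⊗ B)) (index (toℕ a)) (index (toℕ b)))
          (entry-⊗ A B (odd⇒m/2<m p p-odd) (odd⇒m/2<m p p-odd) (M₃-index< 3≤q a) (M₃-index< 3≤q b))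
    where
    index : ∀ t → p * q / 2 ∸ 1 + t ≡ q * (p / 2) + (q / 2 ∸ 1 + t)
    index = M₃-index-⊗ p q p-odd (≤-trans (s≤s (s≤s z≤n)) 3≤q)

  kron-order-odd : ∀ n (ord : Fin (suc n) → ℕ) (B : (i : Fin (suc n)) → Mat (ord i)) →
                   (∀ i → ord i % 2 ≡ 1) → proj₁ (kron n ord B) % 2 ≡ 1
  kron-order-odd zero    ord B odd = odd zero
  kron-order-odd (suc n) ord B odd = begin
    ord zero * q % 2              ≡⟨ %-distribˡ-* (ord zero) q 2 ⟩
    ord zero % 2 * (q % 2) % 2
      ≡⟨ cong₂ (λ x y → x * y % 2) (odd zero) (kron-order-odd n _ _ (λ i → odd (suc i))) ⟩
    1                             ∎
    where
    open ≡-Reasoning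
    q : ℕ
    q = proj₁ (kron n (λ i → ord (suc i)) (λ i → B (suc i)))

  kron-order-≥3 : ∀ n (ord : Fin (suc n) → ℕ) (B : (i : Fin (suc n)) → Mat (ord i)) →
                  (∀ i → 3 ≤ ord i) → 3 ≤ proj₁ (kron n ord B)
  kron-order-≥3 zero    ord B ≥3 = ≥3 zero
  kron-order-≥3 (suc n) ord B ≥3 =
    ≤-trans (kron-order-≥3 n _ _ (λ i → ≥3 (suc i)))
            (m≤n*m _ (ord zero) {{>-nonZero (≤-trans (s≤s z≤n) (≥3 zero))}})

  center-kron : ∀ n (ord : Fin (suc n) → ℕ) (B : (i : Fin (suc n)) → Mat (ord i)) →
                (∀ i → ord i % 2 ≡ 1) →
                center (proj₂ (kron n ord B)) ≈ prod (suc n) (λ i → center (B i))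
  center-kron zero    ord B odd = ≈-sym (*-identityʳ _)
  center-kron (suc n) ord B odd = begin
    center (B zero ⊗ proj₂ rest)            ≡⟨ center-⊗ (B zero) (proj₂ rest) {{rest-nonZero}} (odd zero) ⟩
    center (B zero) · center (proj₂ rest)   ≈⟨ *-cong ≈-refl (center-kron n _ _ (λ i → odd (suc i))) ⟩
    prod (suc (suc n)) (λ i → center (B i)) ∎
    where
    open Relation.Binary.Reasoning.Setoid setoid
    rest : Σ ℕ Mat
    rest = kron n (λ i → ord (suc i)) (λ i → B (suc i))
    rest-nonZero : NonZero (proj₁ rest)
    rest-nonZero = odd⇒nonZero (kron-order-odd n _ _ (λ i → odd (suc i)))

  M₃-kron : ∀ n (ord : Fin (suc n) → ℕ) (B : (i : Fin (suc n)) → Mat (ord i)) →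
            (∀ i → ord i % 2 ≡ 1) → (∀ i → 3 ≤ ord i) →
            M₃ (proj₂ (kron n ord B)) ≈₃ (prod n (λ i → center (B (inject₁ i))) ·₃ M₃ (B (fromℕ n)))
  M₃-kron zero    ord B odd ≥3 a b = ≈-sym (*-identityˡ _)
  M₃-kron (suc n) ord B odd ≥3 a b = begin
    M₃ (B zero ⊗ proj₂ rest) a b
      ≡⟨ M₃-⊗ (B zero) (proj₂ rest) (odd zero) (kron-order-≥3 n _ _ (λ i → ≥3 (suc i))) a b ⟩
    center (B zero) · M₃ (proj₂ rest) a b
      ≈⟨ *-cong ≈-refl (M₃-kron n _ _ (λ i → odd (suc i)) (λ i → ≥3 (suc i)) a b) ⟩
    center (B zero) · (centers · M₃ (B (fromℕ (suc n))) a b)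
      ≈⟨ *-assoc _ _ _ ⟨
    center (B zero) · centers · M₃ (B (fromℕ (suc n))) a b ∎
    where
    open Relation.Binary.Reasoning.Setoid setoid
    rest : Σ ℕ Mat
    rest = kron n (λ i → ord (suc i)) (λ i → B (suc i))
    centers : Carrier
    centers = prod n (λ i → center (B (suc (inject₁ i))))

proposition3p3 : {c ℓ : Level} (R : CommutativeRing c ℓ)
    → let open Matrices R in
      (n : ℕ) (k : Fin (suc n) → ℕ)
      (B : (i : Fin (suc n)) → Mat (3 + 2 * k i))
    → (center (proj₂ (kron n (λ i → 3 + 2 * k i) B))
         ≈R prod (suc n) (λ i → center (B i)))
      × (M₃ (proj₂ (kron n (λ i → 3 + 2 * k i) B))
         ≈₃ (prod n (λ i → center (B (inject₁ i))) ·₃ M₃ (B (fromℕ n))))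
proposition3p3 R n k B =
  center-kron R n ord B (λ i → [3+2*k]%2≡1 (k i)) ,
  M₃-kron R n ord B (λ i → [3+2*k]%2≡1 (k i)) (λ i → m≤m+n 3 (2 * k i))
  where
  ord : Fin (suc n) → ℕ
  ord i = 3 + 2 * k i
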